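{- Let $\psi(\overline{x},y)$ be a formula of Presburger arithmetic (over $\mathbb{Z}$), with $y$ a single variable. If $\forall\overline{x}.\exists y.\psi(\overline{x},y)$ is valid, then $\forall\overline{x},z.\exists y.\big(\psi(\overline{x},y)\wedge\forall w.[\psi(\overline{x},w)\to|y-z|\le|w-z|]\big)$ is also valid. -}

module Defs where

open import Data.Nat using (ℕ; suc)
open import Data.Fin using (Fin)
open import Data.Integer using (ℤ; _+_; -_; _≤_; _<_; 0ℤ; 1ℤ)
open import Data.Vec using (Vec; _∷_; lookup)
open import Data.Product using (Σ; _×_)
open import Data.Sum using (_⊎_)
open import Data.Empty using (⊥)
open import Data.Unit using (⊤)
open import Relation.Binary.PropositionalEquality using (_≡_)

-- First-order language of Presburger arithmetic over ℤ: {0, 1, +, -, <, ≤, =}.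
-- Variables are de Bruijn indices: a term/formula of scope n has n free variables.

data Term (n : ℕ) : Set where
  var  : Fin n → Term n
  zer  : Term n
  one  : Term n
  _⊕_  : Term n → Term n → Term n
  ⊖_   : Term n → Term n

data Formula (n : ℕ) : Set where
  _≐_   : Term n → Term n → Formula n
  _≺_   : Term n → Term n → Formula n
  _≼_   : Term n → Term n → Formula n
  ⊤′ ⊥′ : Formula n
  ¬′_   : Formula n → Formula n
  _∧′_ _∨′_ _⇒′_ : Formula n → Formula n → Formula n
  ∀′ ∃′ : Formula (suc n) → Formula n

⟦_⟧t : ∀ {n} → Term n → Vec ℤ n → ℤ
⟦ var i ⟧t ρ = lookup ρ i
⟦ zer ⟧t ρ = 0ℤ
⟦ one ⟧t ρ = 1ℤ
⟦ s ⊕ t ⟧t ρ = ⟦ s ⟧t ρ + ⟦ t ⟧t ρ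
⟦ ⊖ t ⟧t ρ = - ⟦ t ⟧t ρ

⟦_⟧ : ∀ {n} → Formula n → Vec ℤ n → Set
⟦ s ≐ t ⟧ ρ = ⟦ s ⟧t ρ ≡ ⟦ t ⟧t ρ
⟦ s ≺ t ⟧ ρ = ⟦ s ⟧t ρ < ⟦ t ⟧t ρ
⟦ s ≼ t ⟧ ρ = ⟦ s ⟧t ρ ≤ ⟦ t ⟧t ρ
⟦ ⊤′ ⟧ ρ = ⊤
⟦ ⊥′ ⟧ ρ = ⊥
⟦ ¬′ φ ⟧ ρ = ⟦ φ ⟧ ρ → ⊥
⟦ φ ∧′ ψ ⟧ ρ = ⟦ φ ⟧ ρ × ⟦ ψ ⟧ ρ
⟦ φ ∨′ ψ ⟧ ρ = ⟦ φ ⟧ ρ ⊎ ⟦ ψ ⟧ ρ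
⟦ φ ⇒′ ψ ⟧ ρ = ⟦ φ ⟧ ρ → ⟦ ψ ⟧ ρ
⟦ ∀′ φ ⟧ ρ = (y : ℤ) → ⟦ φ ⟧ (y ∷ ρ)
⟦ ∃′ φ ⟧ ρ = Σ ℤ (λ y → ⟦ φ ⟧ (y ∷ ρ))

-- A solution closest to z is found by trying the distances d = 0, 1, 2, … in turn and asking
-- whether z - d or z + d solves ψ; some distance succeeds because ψ has a solution, and the
-- first one is a closest solution. Constructively this search needs ψ(x̄, y) to be decidable,
-- which holds because Presburger arithmetic admits quantifier elimination (Cooper). To
-- eliminate ∃y, scale every constraint so that y has coefficient ±1 and pass to x = L y with
-- L ∣ x. Let δ be the product of the divisors in the result. Far to the left the formula
-- agrees with its "x = -∞" form, which is δ-periodic, and a solution that is not within δ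
-- above some lower bound b can be moved down by δ. Hence ∃x holds iff the -∞ form holds at
-- one of 0, …, δ - 1 or the formula holds at some b + j with 1 ≤ j ≤ δ, a quantifier-free
-- condition.

module Submission where

open import Defs

module Presburger where
  open import Data.Nat as ℕ using (ℕ; zero; suc)
  import Data.Nat.Properties as ℕₚ
  open import Data.Integer hiding (suc)
  open import Data.Integer.Properties
  open import Data.Integer.Divisibility.Signed
  open import Data.Integer.DivMod using (_/_; _%_; n%d<d; a≡a%n+[a/n]*n)
  open import Data.Integer.Tactic.RingSolver using (solve-∀)
  open import Data.Fin as Fin using (Fin)
  open import Data.Vec using (Vec; _∷_; lookup)
  open import Data.Product using (∃; _×_; _,_; proj₁; proj₂; uncurry)
  open import Data.Product.Function.NonDependent.Propositional using (_×-⇔_)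
  open import Data.Sum as Sum using (_⊎_; inj₁; inj₂; [_,_])
  open import Data.Sum.Function.Propositional using (_⊎-⇔_)
  open import Data.Empty using (⊥)
  open import Data.Unit using (⊤; tt)
  open import Function using (_∘_; id; const)
  open import Function.Bundles using (_⇔_; mk⇔; Equivalence)
  open import Function.Construct.Identity using (⇔-id)
  open import Function.Construct.Symmetry using (⇔-sym)
  open import Function.Construct.Composition using (_⇔-∘_)
  open import Function.Related.Propositional using (module EquationalReasoning)
  open import Function.Related.TypeIsomorphisms using (¬-cong-⇔; →-cong-⇔)
  open import Relation.Nullary using (¬_; Dec; yes; no; contradiction)
  open import Relation.Nullary.Negation using (∀⟶¬∃¬; ¬∃⟶∀¬)
  import Relation.Nullary.Decidable as Dec
  open import Relation.Nullary.Decidable using (¬?; _×-dec_; _⊎-dec_; decidable-stable)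
  open import Relation.Binary.PropositionalEquality
    using (_≡_; refl; sym; trans; cong; cong₂; subst; subst₂; module ≡-Reasoning)
  open Equivalence using (to; from)

  private variable
    n : ℕ
    a b v : ℤ
    A B : Set

  ≡⇒⇔ : A ≡ B → A ⇔ B
  ≡⇒⇔ refl = ⇔-id _

  ¬×⇔¬⊎¬ : Dec A → (¬ (A × B)) ⇔ (¬ A ⊎ ¬ B)
  ¬×⇔¬⊎¬ {A} {B} A? = mk⇔ (split A?) [ (λ ¬a → ¬a ∘ proj₁) , (λ ¬b → ¬b ∘ proj₂) ]
    where
    split : Dec A → ¬ (A × B) → ¬ A ⊎ ¬ B
    split (yes a) ¬a×b = inj₂ (λ b → ¬a×b (a , b))
    split (no ¬a) _ = inj₁ ¬a

  ¬⊎⇔¬×¬ : (¬ (A ⊎ B)) ⇔ (¬ A × ¬ B)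
  ¬⊎⇔¬×¬ = mk⇔ (λ ¬a⊎b → ¬a⊎b ∘ inj₁ , ¬a⊎b ∘ inj₂) (uncurry [_,_])

  →⇔¬⊎ : Dec A → (A → B) ⇔ (¬ A ⊎ B)
  →⇔¬⊎ {A} {B} A? = mk⇔ (split A?) [ (λ ¬a a → contradiction a ¬a) , const ]
    where
    split : Dec A → (A → B) → ¬ A ⊎ B
    split (yes a) f = inj₂ (f a)
    split (no ¬a) _ = inj₁ ¬a

  ∀-cong-⇔ : {P Q : ℤ → Set} → (∀ y → P y ⇔ Q y) → (∀ y → P y) ⇔ (∀ y → Q y)
  ∀-cong-⇔ P⇔Q = mk⇔ (λ ∀P y → to (P⇔Q y) (∀P y)) (λ ∀Q y → from (P⇔Q y) (∀Q y))

  ∃-cong-⇔ : {P Q : ℤ → Set} → (∀ y → P y ⇔ Q y) → (∃ λ y → P y) ⇔ (∃ λ y → Q y)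
  ∃-cong-⇔ P⇔Q = mk⇔ (λ (y , Py) → y , to (P⇔Q y) Py) (λ (y , Qy) → y , from (P⇔Q y) Qy)

  ∀⇔¬∃¬ : {P : ℤ → Set} → (∀ y → Dec (P y)) → (∀ y → P y) ⇔ (¬ ∃ λ y → ¬ P y)
  ∀⇔¬∃¬ P? = mk⇔ ∀⟶¬∃¬ λ ¬∃¬P y → decidable-stable (P? y) (¬∃⟶∀¬ ¬∃¬P y)

  <⇔0<- : a < b ⇔ 0ℤ < b - a
  <⇔0<- {a} {b} = mk⇔
    (λ a<b → subst (_< b - a) (+-inverseʳ a) (+-monoˡ-< (- a) a<b))
    (λ 0<b-a → subst₂ _<_ (+-identityˡ a) (b-a+a≡b a b) (+-monoˡ-< a 0<b-a))
    where
    b-a+a≡b : ∀ a b → b - a + a ≡ b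
    b-a+a≡b = solve-∀

  ≤⇔<1+ : a ≤ b ⇔ a < 1ℤ + b
  ≤⇔<1+ {a} {b} = mk⇔
    (λ a≤b → suc[i]≤j⇒i<j (+-monoʳ-≤ 1ℤ a≤b))
    (λ a<1+b → subst (a ≤_) (pred-suc b) (i<j⇒i≤pred[j] a<1+b))

  ≮0⇔≤0 : (¬ 0ℤ < v) ⇔ v ≤ 0ℤ
  ≮0⇔≤0 = mk⇔ ≮⇒≥ ≤⇒≯

  ≡⇔≤×≥ : a ≡ b ⇔ (a ≤ b × b ≤ a)
  ≡⇔≤×≥ = mk⇔ (λ a≡b → ≤-reflexive a≡b , ≤-reflexive (sym a≡b)) (uncurry ≤-antisym)

  0<*⇔0< : ∀ k → 0ℤ < + suc k * v ⇔ 0ℤ < v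
  0<*⇔0< {v} k = mk⇔
    (*-cancelˡ-<-nonNeg c ∘ subst (_< c * v) (sym (*-zeroʳ c)))
    (subst (_< c * v) (*-zeroʳ c) ∘ *-monoˡ-<-pos c)
    where
    c = + suc k

  pos-*-≡ : ∀ k l {m} → k ℕ.* l ≡ m → + m ≡ + k * + l
  pos-*-≡ k l refl = pos-* k l

  i≤+∣i∣ : ∀ i → i ≤ + ∣ i ∣
  i≤+∣i∣ (+ n) = ≤-refl
  i≤+∣i∣ -[1+ n ] = -≤+

  descend : ∀ (P : ℤ → Set) {R : Set} {D} → 0ℤ < D → (∀ x → P x → R ⊎ P (x - D)) →
            ∀ M {x} → P x → R ⊎ ∃ λ x′ → x′ ≤ M × P x′
  descend P {R} {D} 0<D step M {x} Px = go ∣ x - M ∣ x≤M+∣x-M∣ Px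
    where
    x≤M+∣x-M∣ : x ≤ M + + ∣ x - M ∣
    x≤M+∣x-M∣ = subst (_≤ M + + ∣ x - M ∣) (M+[x-M]≡x M x) (+-monoʳ-≤ M (i≤+∣i∣ (x - M)))
      where
      M+[x-M]≡x : ∀ M x → M + (x - M) ≡ x
      M+[x-M]≡x = solve-∀
    go : ∀ k {x} → x ≤ M + + k → P x → R ⊎ ∃ λ x′ → x′ ≤ M × P x′
    go zero {x} x≤M+0 Px = inj₂ (x , subst (x ≤_) (+-identityʳ M) x≤M+0 , Px)
    go (suc k) {x} x≤M+1+k Px with step x Px
    ... | inj₁ r = inj₁ r
    ... | inj₂ Px-D = go k x-D≤M+k Px-D
      where
      M+1+k-1≡M+k : ∀ M K → M + (1ℤ + K) - 1ℤ ≡ M + K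
      M+1+k-1≡M+k = solve-∀
      x-D≤M+k : x - D ≤ M + + k
      x-D≤M+k = ≤-trans (+-monoʳ-≤ x (neg-mono-≤ (i<j⇒suc[i]≤j 0<D)))
                        (subst (x - 1ℤ ≤_) (M+1+k-1≡M+k M (+ k)) (+-monoˡ-≤ -1ℤ x≤M+1+k))

  -- Positive naturals are encoded shifted by one, so that divisors are never zero:
  -- k ∣⁺ v means suc k ∣ v, and suc (k ⊛ l) reduces to suc k * suc l.
  _∣⁺_ : ℕ → ℤ → Set
  k ∣⁺ v = + suc k ∣ v

  _⊛_ : ℕ → ℕ → ℕ
  k ⊛ l = l ℕ.+ k ℕ.* suc l

  ∣⊛ˡ : ∀ k l → + suc k ∣ + suc (k ⊛ l)
  ∣⊛ˡ k l = subst (+ suc k ∣_) (sym (pos-* (suc k) (suc l))) (∣m⇒∣m*n (+ suc l) ∣-refl)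

  ∣⊛ʳ : ∀ k l → + suc l ∣ + suc (k ⊛ l)
  ∣⊛ʳ k l = subst (+ suc l ∣_) (sym (pos-* (suc k) (suc l))) (∣n⇒∣m*n (+ suc k) ∣-refl)

  ∣⁺-shift : ∀ k a x r {m} → + suc k ∣ m → k ∣⁺ (a * x + r) ⇔ k ∣⁺ (a * (x + m) + r)
  ∣⁺-shift k a x r {m} k∣m = mk⇔
    (λ k∣ax+r → subst (k ∣⁺_) (sym (split a x m r)) (∣m∣n⇒∣m+n k∣ax+r k∣am))
    (λ k∣a[x+m]+r → ∣m+n∣n⇒∣m (subst (k ∣⁺_) (split a x m r) k∣a[x+m]+r) k∣am)
    where
    k∣am = ∣n⇒∣m*n a k∣m
    split : ∀ a x m r → a * (x + m) + r ≡ a * x + r + a * m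
    split = solve-∀

  -- Linear terms and quantifier-free formulas

  infixl 6 _⊞_
  infixr 7 _⊠_

  data Lin (n : ℕ) : Set where
    var : Fin n → Lin n
    con : ℤ → Lin n
    _⊞_ : Lin n → Lin n → Lin n
    _⊠_ : ℤ → Lin n → Lin n
    ⊟_  : Lin n → Lin n

  ⟦_⟧ˡ : Lin n → Vec ℤ n → ℤ
  ⟦ var i ⟧ˡ ρ = lookup ρ i
  ⟦ con c ⟧ˡ ρ = c
  ⟦ s ⊞ t ⟧ˡ ρ = ⟦ s ⟧ˡ ρ + ⟦ t ⟧ˡ ρ
  ⟦ c ⊠ t ⟧ˡ ρ = c * ⟦ t ⟧ˡ ρ
  ⟦ ⊟ t ⟧ˡ ρ = - ⟦ t ⟧ˡ ρ

  coeff : Lin (suc n) → ℤ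
  coeff (var Fin.zero) = 1ℤ
  coeff (var (Fin.suc i)) = 0ℤ
  coeff (con c) = 0ℤ
  coeff (s ⊞ t) = coeff s + coeff t
  coeff (c ⊠ t) = c * coeff t
  coeff (⊟ t) = - coeff t

  rest : Lin (suc n) → Lin n
  rest (var Fin.zero) = con 0ℤ
  rest (var (Fin.suc i)) = var i
  rest (con c) = con c
  rest (s ⊞ t) = rest s ⊞ rest t
  rest (c ⊠ t) = c ⊠ rest t
  rest (⊟ t) = ⊟ rest t

  c≡0*y+c : ∀ y c → c ≡ 0ℤ * y + c
  c≡0*y+c = solve-∀

  coeff-rest : ∀ (t : Lin (suc n)) y ρ → ⟦ t ⟧ˡ (y ∷ ρ) ≡ coeff t * y + ⟦ rest t ⟧ˡ ρ
  coeff-rest (var Fin.zero) y ρ = y≡1*y+0 y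
    where
    y≡1*y+0 : ∀ y → y ≡ 1ℤ * y + 0ℤ
    y≡1*y+0 = solve-∀
  coeff-rest (var (Fin.suc i)) y ρ = c≡0*y+c y (lookup ρ i)
  coeff-rest (con c) y ρ = c≡0*y+c y c
  coeff-rest (s ⊞ t) y ρ =
    trans (cong₂ _+_ (coeff-rest s y ρ) (coeff-rest t y ρ))
          (distrib (coeff s) (coeff t) y (⟦ rest s ⟧ˡ ρ) (⟦ rest t ⟧ˡ ρ))
    where
    distrib : ∀ a b y u v → a * y + u + (b * y + v) ≡ (a + b) * y + (u + v)
    distrib = solve-∀
  coeff-rest (c ⊠ t) y ρ = trans (cong (c *_) (coeff-rest t y ρ)) (distrib c (coeff t) y (⟦ rest t ⟧ˡ ρ))
    where
    distrib : ∀ c a y u → c * (a * y + u) ≡ c * a * y + c * u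
    distrib = solve-∀
  coeff-rest (⊟ t) y ρ = trans (cong -_ (coeff-rest t y ρ)) (distrib (coeff t) y (⟦ rest t ⟧ˡ ρ))
    where
    distrib : ∀ a y u → - (a * y + u) ≡ - a * y + - u
    distrib = solve-∀

  infixr 2 _∨ᵠ_
  infixr 3 _∧ᵠ_
  infix 4 _<ˡ_ _≤ˡ_

  data QF (n : ℕ) : Set where
    ⊤ᵠ ⊥ᵠ     : QF n
    0<_       : Lin n → QF n
    dvd ndvd  : ℕ → Lin n → QF n
    _∧ᵠ_ _∨ᵠ_ : QF n → QF n → QF n

  ⟦_⟧ᵠ : QF n → Vec ℤ n → Set
  ⟦ ⊤ᵠ ⟧ᵠ ρ = ⊤
  ⟦ ⊥ᵠ ⟧ᵠ ρ = ⊥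
  ⟦ 0< t ⟧ᵠ ρ = 0ℤ < ⟦ t ⟧ˡ ρ
  ⟦ dvd k t ⟧ᵠ ρ = k ∣⁺ ⟦ t ⟧ˡ ρ
  ⟦ ndvd k t ⟧ᵠ ρ = ¬ k ∣⁺ ⟦ t ⟧ˡ ρ
  ⟦ p ∧ᵠ q ⟧ᵠ ρ = ⟦ p ⟧ᵠ ρ × ⟦ q ⟧ᵠ ρ
  ⟦ p ∨ᵠ q ⟧ᵠ ρ = ⟦ p ⟧ᵠ ρ ⊎ ⟦ q ⟧ᵠ ρ

  ⟦_⟧ᵠ? : (p : QF n) (ρ : Vec ℤ n) → Dec (⟦ p ⟧ᵠ ρ)
  ⟦ ⊤ᵠ ⟧ᵠ? ρ = yes tt
  ⟦ ⊥ᵠ ⟧ᵠ? ρ = no id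
  ⟦ 0< t ⟧ᵠ? ρ = 0ℤ <? ⟦ t ⟧ˡ ρ
  ⟦ dvd k t ⟧ᵠ? ρ = + suc k ∣? ⟦ t ⟧ˡ ρ
  ⟦ ndvd k t ⟧ᵠ? ρ = ¬? (+ suc k ∣? ⟦ t ⟧ˡ ρ)
  ⟦ p ∧ᵠ q ⟧ᵠ? ρ = ⟦ p ⟧ᵠ? ρ ×-dec ⟦ q ⟧ᵠ? ρ
  ⟦ p ∨ᵠ q ⟧ᵠ? ρ = ⟦ p ⟧ᵠ? ρ ⊎-dec ⟦ q ⟧ᵠ? ρ

  _<ˡ_ _≤ˡ_ : Lin n → Lin n → QF n
  s <ˡ t = 0< (t ⊞ ⊟ s)
  s ≤ˡ t = s <ˡ con 1ℤ ⊞ t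

  <ˡ-correct : ∀ (s t : Lin n) ρ → ⟦ s ⟧ˡ ρ < ⟦ t ⟧ˡ ρ ⇔ ⟦ s <ˡ t ⟧ᵠ ρ
  <ˡ-correct s t ρ = <⇔0<-

  ≤ˡ-correct : ∀ (s t : Lin n) ρ → ⟦ s ⟧ˡ ρ ≤ ⟦ t ⟧ˡ ρ ⇔ ⟦ s ≤ˡ t ⟧ᵠ ρ
  ≤ˡ-correct s t ρ = <⇔0<- ⇔-∘ ≤⇔<1+

  negᵠ : QF n → QF n
  negᵠ ⊤ᵠ = ⊥ᵠ
  negᵠ ⊥ᵠ = ⊤ᵠ
  negᵠ (0< t) = t ≤ˡ con 0ℤ
  negᵠ (dvd k t) = ndvd k t
  negᵠ (ndvd k t) = dvd k t
  negᵠ (p ∧ᵠ q) = negᵠ p ∨ᵠ negᵠ q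
  negᵠ (p ∨ᵠ q) = negᵠ p ∧ᵠ negᵠ q

  negᵠ-correct : ∀ (p : QF n) ρ → (¬ ⟦ p ⟧ᵠ ρ) ⇔ ⟦ negᵠ p ⟧ᵠ ρ
  negᵠ-correct ⊤ᵠ ρ = mk⇔ (λ ¬⊤ → ¬⊤ tt) λ ()
  negᵠ-correct ⊥ᵠ ρ = mk⇔ (λ _ → tt) λ _ ()
  negᵠ-correct (0< t) ρ = ≤ˡ-correct t (con 0ℤ) ρ ⇔-∘ ≮0⇔≤0
  negᵠ-correct (dvd k t) ρ = ⇔-id _
  negᵠ-correct (ndvd k t) ρ = mk⇔ (decidable-stable (+ suc k ∣? ⟦ t ⟧ˡ ρ)) λ k∣t ¬k∣t → ¬k∣t k∣t
  negᵠ-correct (p ∧ᵠ q) ρ = (negᵠ-correct p ρ ⊎-⇔ negᵠ-correct q ρ) ⇔-∘ ¬×⇔¬⊎¬ (⟦ p ⟧ᵠ? ρ)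
  negᵠ-correct (p ∨ᵠ q) ρ = (negᵠ-correct p ρ ×-⇔ negᵠ-correct q ρ) ⇔-∘ ¬⊎⇔¬×¬

  bigOr : ℕ → (ℕ → QF n) → QF n
  bigOr zero f = ⊥ᵠ
  bigOr (suc N) f = f N ∨ᵠ bigOr N f

  syntax bigOr N (λ j → p) = ⋁[ j < N ] p

  bigOr-intro : ∀ (f : ℕ → QF n) {N j} ρ → j ℕ.< N → ⟦ f j ⟧ᵠ ρ → ⟦ bigOr N f ⟧ᵠ ρ
  bigOr-intro f {suc N} ρ j<1+N h with ℕₚ.m<1+n⇒m<n∨m≡n j<1+N
  ... | inj₁ j<N = inj₂ (bigOr-intro f ρ j<N h)
  ... | inj₂ refl = inj₁ h

  bigOr-elim : ∀ (f : ℕ → QF n) N ρ → ⟦ bigOr N f ⟧ᵠ ρ → ∃ λ j → ⟦ f j ⟧ᵠ ρ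
  bigOr-elim f (suc N) ρ (inj₁ h) = N , h
  bigOr-elim f (suc N) ρ (inj₂ h) = bigOr-elim f N ρ h

  -- Formulas in one distinguished variable x, which occurs in inequalities only with
  -- coefficient ±1: lower t means 0 < x + t and upper t means 0 < - x + t.
  infixr 2 _∨ᵘ_
  infixr 3 _∧ᵘ_

  data UQF (n : ℕ) : Set where
    lower upper : Lin n → UQF n
    free        : QF n → UQF n
    dvdₓ ndvdₓ  : ℕ → ℤ → Lin n → UQF n
    _∧ᵘ_ _∨ᵘ_   : UQF n → UQF n → UQF n

  ⟦_⟧ᵘ : UQF n → ℤ → Vec ℤ n → Set
  ⟦ lower t ⟧ᵘ x ρ = 0ℤ < x + ⟦ t ⟧ˡ ρ
  ⟦ upper t ⟧ᵘ x ρ = 0ℤ < - x + ⟦ t ⟧ˡ ρ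
  ⟦ free p ⟧ᵘ x ρ = ⟦ p ⟧ᵠ ρ
  ⟦ dvdₓ k a t ⟧ᵘ x ρ = k ∣⁺ (a * x + ⟦ t ⟧ˡ ρ)
  ⟦ ndvdₓ k a t ⟧ᵘ x ρ = ¬ k ∣⁺ (a * x + ⟦ t ⟧ˡ ρ)
  ⟦ u ∧ᵘ v ⟧ᵘ x ρ = ⟦ u ⟧ᵘ x ρ × ⟦ v ⟧ᵘ x ρ
  ⟦ u ∨ᵘ v ⟧ᵘ x ρ = ⟦ u ⟧ᵘ x ρ ⊎ ⟦ v ⟧ᵘ x ρ

  -- ∣ a ∣ in the shifted encoding, with 0 treated like 1.
  ∣_∣⁻ : ℤ → ℕ
  ∣ +0 ∣⁻ = 0
  ∣ +[1+ m ] ∣⁻ = m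
  ∣ -[1+ m ] ∣⁻ = m

  coeffProduct : QF (suc n) → ℕ
  coeffProduct (0< t) = ∣ coeff t ∣⁻
  coeffProduct (p ∧ᵠ q) = coeffProduct p ⊛ coeffProduct q
  coeffProduct (p ∨ᵠ q) = coeffProduct p ⊛ coeffProduct q
  coeffProduct _ = 0

  -- 0 < a * y + t multiplied by suc r, where suc r * ∣ a ∣ = suc L, read as a constraint on x = suc L * y.
  unitise-< : ℕ → ℤ → Lin n → UQF n
  unitise-< r +0 t = free (0< t)
  unitise-< r +[1+ m ] t = lower (+ suc r ⊠ t)
  unitise-< r -[1+ m ] t = upper (+ suc r ⊠ t)

  unitise : ℕ → ℕ → QF (suc n) → UQF n
  unitise L r ⊤ᵠ = free ⊤ᵠ
  unitise L r ⊥ᵠ = free ⊥ᵠ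
  unitise L r (0< t) = unitise-< r (coeff t) (rest t)
  unitise L r (dvd k t) = dvdₓ (L ⊛ k) (coeff t) (+ suc L ⊠ rest t)
  unitise L r (ndvd k t) = ndvdₓ (L ⊛ k) (coeff t) (+ suc L ⊠ rest t)
  unitise L r (p ∧ᵠ q) = unitise L (r ⊛ coeffProduct q) p ∧ᵘ unitise L (r ⊛ coeffProduct p) q
  unitise L r (p ∨ᵠ q) = unitise L (r ⊛ coeffProduct q) p ∨ᵘ unitise L (r ⊛ coeffProduct p) q

  unitise-<-correct : ∀ r a (t : Lin n) {L} → suc r ℕ.* suc ∣ a ∣⁻ ≡ suc L → ∀ y ρ →
                      ⟦ unitise-< r a t ⟧ᵘ (+ suc L * y) ρ ⇔ 0ℤ < a * y + ⟦ t ⟧ˡ ρ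
  unitise-<-correct r +0 t eq y ρ = ≡⇒⇔ (cong (0ℤ <_) (c≡0*y+c y (⟦ t ⟧ˡ ρ)))
  unitise-<-correct r +[1+ m ] t {L} eq y ρ = 0<*⇔0< r ⇔-∘ ≡⇒⇔ (cong (0ℤ <_) (begin
    + suc L * y + c * ⟦ t ⟧ˡ ρ       ≡⟨ cong (λ l → l * y + c * ⟦ t ⟧ˡ ρ) (pos-*-≡ (suc r) (suc m) eq) ⟩
    c * +[1+ m ] * y + c * ⟦ t ⟧ˡ ρ  ≡⟨ distrib c +[1+ m ] y (⟦ t ⟧ˡ ρ) ⟩
    c * (+[1+ m ] * y + ⟦ t ⟧ˡ ρ)    ∎))
    where
    open ≡-Reasoning
    c = + suc r
    distrib : ∀ c a y u → c * a * y + c * u ≡ c * (a * y + u)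
    distrib = solve-∀
  unitise-<-correct r -[1+ m ] t {L} eq y ρ = 0<*⇔0< r ⇔-∘ ≡⇒⇔ (cong (0ℤ <_) (begin
    - (+ suc L * y) + c * ⟦ t ⟧ˡ ρ       ≡⟨ cong (λ l → - (l * y) + c * ⟦ t ⟧ˡ ρ) (pos-*-≡ (suc r) (suc m) eq) ⟩
    - (c * +[1+ m ] * y) + c * ⟦ t ⟧ˡ ρ  ≡⟨ distrib c +[1+ m ] y (⟦ t ⟧ˡ ρ) ⟩
    c * (-[1+ m ] * y + ⟦ t ⟧ˡ ρ)        ∎))
    where
    open ≡-Reasoning
    c = + suc r
    distrib : ∀ c a y u → - (c * a * y) + c * u ≡ c * (- a * y + u)
    distrib = solve-∀

  unitise-∣ : ∀ L k (t : Lin (suc n)) y ρ →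
              (L ⊛ k) ∣⁺ (coeff t * (+ suc L * y) + + suc L * ⟦ rest t ⟧ˡ ρ) ⇔ k ∣⁺ ⟦ t ⟧ˡ (y ∷ ρ)
  unitise-∣ L k t y ρ = mk⇔ (*-cancelˡ-∣ ℓ) (*-monoʳ-∣ ℓ) ⇔-∘ ≡⇒⇔ (cong₂ _∣_ (pos-* (suc L) (suc k))
    (trans (distrib ℓ (coeff t) y (⟦ rest t ⟧ˡ ρ)) (cong (ℓ *_) (sym (coeff-rest t y ρ)))))
    where
    ℓ = + suc L
    distrib : ∀ ℓ a y u → a * (ℓ * y) + ℓ * u ≡ ℓ * (a * y + u)
    distrib = solve-∀

  cofactorˡ : ∀ r a b {L} → suc r ℕ.* suc (a ⊛ b) ≡ suc L → suc (r ⊛ b) ℕ.* suc a ≡ suc L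
  cofactorˡ r a b eq =
    trans (trans (ℕₚ.*-assoc (suc r) (suc b) (suc a)) (cong (suc r ℕ.*_) (ℕₚ.*-comm (suc b) (suc a)))) eq

  cofactorʳ : ∀ r a b {L} → suc r ℕ.* suc (a ⊛ b) ≡ suc L → suc (r ⊛ a) ℕ.* suc b ≡ suc L
  cofactorʳ r a b eq = trans (ℕₚ.*-assoc (suc r) (suc a) (suc b)) eq

  unitise-correct : ∀ L r (p : QF (suc n)) → suc r ℕ.* suc (coeffProduct p) ≡ suc L → ∀ y ρ →
                    ⟦ unitise L r p ⟧ᵘ (+ suc L * y) ρ ⇔ ⟦ p ⟧ᵠ (y ∷ ρ)
  unitise-correct L r ⊤ᵠ eq y ρ = ⇔-id _
  unitise-correct L r ⊥ᵠ eq y ρ = ⇔-id _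
  unitise-correct L r (0< t) eq y ρ =
    ≡⇒⇔ (cong (0ℤ <_) (sym (coeff-rest t y ρ))) ⇔-∘ unitise-<-correct r (coeff t) (rest t) eq y ρ
  unitise-correct L r (dvd k t) eq y ρ = unitise-∣ L k t y ρ
  unitise-correct L r (ndvd k t) eq y ρ = ¬-cong-⇔ (unitise-∣ L k t y ρ)
  unitise-correct L r (p ∧ᵠ q) eq y ρ =
    unitise-correct L _ p (cofactorˡ r (coeffProduct p) (coeffProduct q) eq) y ρ
    ×-⇔ unitise-correct L _ q (cofactorʳ r (coeffProduct p) (coeffProduct q) eq) y ρ
  unitise-correct L r (p ∨ᵠ q) eq y ρ =
    unitise-correct L _ p (cofactorˡ r (coeffProduct p) (coeffProduct q) eq) y ρ
    ⊎-⇔ unitise-correct L _ q (cofactorʳ r (coeffProduct p) (coeffProduct q) eq) y ρ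

  -- Cooper's elimination of x

  _[_]ᵘ : UQF n → Lin n → QF n
  lower t [ s ]ᵘ = 0< (s ⊞ t)
  upper t [ s ]ᵘ = 0< (⊟ s ⊞ t)
  free p [ s ]ᵘ = p
  dvdₓ k a t [ s ]ᵘ = dvd k (a ⊠ s ⊞ t)
  ndvdₓ k a t [ s ]ᵘ = ndvd k (a ⊠ s ⊞ t)
  (u ∧ᵘ v) [ s ]ᵘ = u [ s ]ᵘ ∧ᵠ v [ s ]ᵘ
  (u ∨ᵘ v) [ s ]ᵘ = u [ s ]ᵘ ∨ᵠ v [ s ]ᵘ

  []ᵘ-correct : ∀ (u : UQF n) s ρ → ⟦ u [ s ]ᵘ ⟧ᵠ ρ ⇔ ⟦ u ⟧ᵘ (⟦ s ⟧ˡ ρ) ρ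
  []ᵘ-correct (lower t) s ρ = ⇔-id _
  []ᵘ-correct (upper t) s ρ = ⇔-id _
  []ᵘ-correct (free p) s ρ = ⇔-id _
  []ᵘ-correct (dvdₓ k a t) s ρ = ⇔-id _
  []ᵘ-correct (ndvdₓ k a t) s ρ = ⇔-id _
  []ᵘ-correct (u ∧ᵘ v) s ρ = []ᵘ-correct u s ρ ×-⇔ []ᵘ-correct v s ρ
  []ᵘ-correct (u ∨ᵘ v) s ρ = []ᵘ-correct u s ρ ⊎-⇔ []ᵘ-correct v s ρ

  divisorProduct : UQF n → ℕ
  divisorProduct (dvdₓ k a t) = k
  divisorProduct (ndvdₓ k a t) = k
  divisorProduct (u ∧ᵘ v) = divisorProduct u ⊛ divisorProduct v
  divisorProduct (u ∨ᵘ v) = divisorProduct u ⊛ divisorProduct v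
  divisorProduct _ = 0

  δ : UQF n → ℕ
  δ u = suc (divisorProduct u)

  0<δ : ∀ (u : UQF n) → 0ℤ < + δ u
  0<δ u = +<+ ℕ.z<s

  δˡ∣δ : ∀ (u v : UQF n) → + δ u ∣ + δ (u ∧ᵘ v)
  δˡ∣δ u v = ∣⊛ˡ (divisorProduct u) (divisorProduct v)

  δʳ∣δ : ∀ (u v : UQF n) → + δ v ∣ + δ (u ∧ᵘ v)
  δʳ∣δ u v = ∣⊛ʳ (divisorProduct u) (divisorProduct v)

  minusInf : UQF n → UQF n
  minusInf (lower t) = free ⊥ᵠ
  minusInf (upper t) = free ⊤ᵠ
  minusInf (free p) = free p
  minusInf (dvdₓ k a t) = dvdₓ k a t
  minusInf (ndvdₓ k a t) = ndvdₓ k a t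
  minusInf (u ∧ᵘ v) = minusInf u ∧ᵘ minusInf v
  minusInf (u ∨ᵘ v) = minusInf u ∨ᵘ minusInf v

  minusInf-periodic : ∀ (u : UQF n) {m x ρ} → + δ u ∣ m → ⟦ minusInf u ⟧ᵘ x ρ → ⟦ minusInf u ⟧ᵘ (x + m) ρ
  minusInf-periodic (upper t) δ∣m _ = tt
  minusInf-periodic (free p) δ∣m holds = holds
  minusInf-periodic (dvdₓ k a t) {x = x} {ρ} δ∣m = to (∣⁺-shift k a x (⟦ t ⟧ˡ ρ) δ∣m)
  minusInf-periodic (ndvdₓ k a t) {x = x} {ρ} δ∣m = to (¬-cong-⇔ (∣⁺-shift k a x (⟦ t ⟧ˡ ρ) δ∣m))
  minusInf-periodic (u ∧ᵘ v) δ∣m (hu , hv) =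
    minusInf-periodic u (∣-trans (δˡ∣δ u v) δ∣m) hu , minusInf-periodic v (∣-trans (δʳ∣δ u v) δ∣m) hv
  minusInf-periodic (u ∨ᵘ v) δ∣m (inj₁ hu) = inj₁ (minusInf-periodic u (∣-trans (δˡ∣δ u v) δ∣m) hu)
  minusInf-periodic (u ∨ᵘ v) δ∣m (inj₂ hv) = inj₂ (minusInf-periodic v (∣-trans (δʳ∣δ u v) δ∣m) hv)

  minusInf-mod : ∀ (u : UQF n) {x ρ} → ⟦ minusInf u ⟧ᵘ x ρ → ⟦ minusInf u ⟧ᵘ (+ (x % + δ u)) ρ
  minusInf-mod u {x} {ρ} h =
    subst (λ y → ⟦ minusInf u ⟧ᵘ y ρ) x-qD≡r (minusInf-periodic u (∣m⇒∣-m (∣n⇒∣m*n (x / D) ∣-refl)) h)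
    where
    open ≡-Reasoning
    D = + δ u
    r+s-s≡r : ∀ r s → r + s - s ≡ r
    r+s-s≡r = solve-∀
    x-qD≡r : x - x / D * D ≡ + (x % D)
    x-qD≡r = begin
      x - x / D * D                      ≡⟨ cong (_- x / D * D) (a≡a%n+[a/n]*n x D) ⟩
      + (x % D) + x / D * D - x / D * D  ≡⟨ r+s-s≡r (+ (x % D)) (x / D * D) ⟩
      + (x % D)                          ∎

  threshold : UQF n → Vec ℤ n → ℤ
  threshold (lower t) ρ = - ⟦ t ⟧ˡ ρ
  threshold (upper t) ρ = pred (⟦ t ⟧ˡ ρ)
  threshold (u ∧ᵘ v) ρ = threshold u ρ ⊓ threshold v ρ
  threshold (u ∨ᵘ v) ρ = threshold u ρ ⊓ threshold v ρ
  threshold _ ρ = 0ℤ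

  minusInf-agrees : ∀ (u : UQF n) {x ρ} → x ≤ threshold u ρ → ⟦ u ⟧ᵘ x ρ ⇔ ⟦ minusInf u ⟧ᵘ x ρ
  minusInf-agrees (lower t) {x} {ρ} x≤-t = mk⇔ (≤⇒≯ x+t≤0) λ ()
    where
    x+t≤0 : x + ⟦ t ⟧ˡ ρ ≤ 0ℤ
    x+t≤0 = subst (x + ⟦ t ⟧ˡ ρ ≤_) (+-inverseˡ (⟦ t ⟧ˡ ρ)) (+-monoˡ-≤ (⟦ t ⟧ˡ ρ) x≤-t)
  minusInf-agrees (upper t) {x} {ρ} x≤t-1 = mk⇔ (λ _ → tt) (λ _ → 0<-x+t)
    where
    0<-x+t : 0ℤ < - x + ⟦ t ⟧ˡ ρ
    0<-x+t = subst (0ℤ <_) (+-comm (⟦ t ⟧ˡ ρ) (- x)) (to (<⇔0<- {x} {⟦ t ⟧ˡ ρ}) (i≤pred[j]⇒i<j x≤t-1))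
  minusInf-agrees (free p) _ = ⇔-id _
  minusInf-agrees (dvdₓ k a t) _ = ⇔-id _
  minusInf-agrees (ndvdₓ k a t) _ = ⇔-id _
  minusInf-agrees (u ∧ᵘ v) x≤θ =
    minusInf-agrees u (≤-trans x≤θ (i⊓j≤i _ _)) ×-⇔ minusInf-agrees v (≤-trans x≤θ (i⊓j≤j _ _))
  minusInf-agrees (u ∨ᵘ v) x≤θ =
    minusInf-agrees u (≤-trans x≤θ (i⊓j≤i _ _)) ⊎-⇔ minusInf-agrees v (≤-trans x≤θ (i⊓j≤j _ _))

  anyLower : UQF n → (Lin n → QF n) → QF n
  anyLower (lower t) g = g t
  anyLower (u ∧ᵘ v) g = anyLower u g ∨ᵠ anyLower v g
  anyLower (u ∨ᵘ v) g = anyLower u g ∨ᵠ anyLower v g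
  anyLower _ g = ⊥ᵠ

  anyLower-elim : ∀ (u : UQF n) g ρ → ⟦ anyLower u g ⟧ᵠ ρ → ∃ λ t → ⟦ g t ⟧ᵠ ρ
  anyLower-elim (lower t) g ρ h = t , h
  anyLower-elim (u ∧ᵘ v) g ρ (inj₁ h) = anyLower-elim u g ρ h
  anyLower-elim (u ∧ᵘ v) g ρ (inj₂ h) = anyLower-elim v g ρ h
  anyLower-elim (u ∨ᵘ v) g ρ (inj₁ h) = anyLower-elim u g ρ h
  anyLower-elim (u ∨ᵘ v) g ρ (inj₂ h) = anyLower-elim v g ρ h

  -- Moving x down by D can only falsify an atom 0 < x + t, and then x lies within D above its bound - t.
  module _ {ρ : Vec ℤ n} (g : Lin n → QF n) {x D : ℤ} (0<D : 0ℤ < D)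
           (near : ∀ t → 0ℤ < x + ⟦ t ⟧ˡ ρ → x + ⟦ t ⟧ˡ ρ ≤ D → ⟦ g t ⟧ᵠ ρ) where

    step-down : ∀ (u : UQF n) → + δ u ∣ D → ⟦ u ⟧ᵘ x ρ → ⟦ u ⟧ᵘ (x - D) ρ ⊎ ⟦ anyLower u g ⟧ᵠ ρ
    step-down (lower t) _ 0<x+t with x + ⟦ t ⟧ˡ ρ ≤? D
    ... | yes x+t≤D = inj₂ (near t 0<x+t x+t≤D)
    ... | no x+t≰D = inj₁ (subst (0ℤ <_) (shuffle x D (⟦ t ⟧ˡ ρ)) (to <⇔0<- (≰⇒> x+t≰D)))
      where
      shuffle : ∀ x D t → x + t - D ≡ x - D + t
      shuffle = solve-∀
    step-down (upper t) _ 0<-x+t = inj₁ (subst (0ℤ <_) (shuffle x D (⟦ t ⟧ˡ ρ)) (+-mono-< 0<-x+t 0<D))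
      where
      shuffle : ∀ x D t → - x + t + D ≡ - (x - D) + t
      shuffle = solve-∀
    step-down (free p) _ h = inj₁ h
    step-down (dvdₓ k a t) δ∣D = inj₁ ∘ to (∣⁺-shift k a x (⟦ t ⟧ˡ ρ) (∣m⇒∣-m δ∣D))
    step-down (ndvdₓ k a t) δ∣D = inj₁ ∘ to (¬-cong-⇔ (∣⁺-shift k a x (⟦ t ⟧ˡ ρ) (∣m⇒∣-m δ∣D)))
    step-down (u ∧ᵘ v) δ∣D (hu , hv)
      with step-down u (∣-trans (δˡ∣δ u v) δ∣D) hu | step-down v (∣-trans (δʳ∣δ u v) δ∣D) hv
    ... | inj₁ hu′ | inj₁ hv′ = inj₁ (hu′ , hv′)
    ... | inj₂ bu  | _        = inj₂ (inj₁ bu)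
    ... | inj₁ _   | inj₂ bv  = inj₂ (inj₂ bv)
    step-down (u ∨ᵘ v) δ∣D (inj₁ hu) = Sum.map inj₁ inj₁ (step-down u (∣-trans (δˡ∣δ u v) δ∣D) hu)
    step-down (u ∨ᵘ v) δ∣D (inj₂ hv) = Sum.map inj₂ inj₂ (step-down v (∣-trans (δʳ∣δ u v) δ∣D) hv)

  justAbove : UQF n → Lin n → QF n
  justAbove u t = ⋁[ j < δ u ] (u [ ⊟ t ⊞ con (+ suc j) ]ᵘ)

  cooper : UQF n → QF n
  cooper u = (⋁[ j < δ u ] (minusInf u [ con (+ j) ]ᵘ)) ∨ᵠ anyLower u (justAbove u)

  justAbove-intro : ∀ (u : UQF n) {x ρ} → ⟦ u ⟧ᵘ x ρ →
                    ∀ t → 0ℤ < x + ⟦ t ⟧ˡ ρ → x + ⟦ t ⟧ˡ ρ ≤ + δ u → ⟦ justAbove u t ⟧ᵠ ρ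
  justAbove-intro u {x} {ρ} hx t 0<x+t x+t≤δ with x + ⟦ t ⟧ˡ ρ in x+t≡
  justAbove-intro u {x} {ρ} hx t (+<+ ()) _ | +0
  justAbove-intro u {x} {ρ} hx t 0<x+t (+≤+ j<δ) | +[1+ j ] =
    bigOr-intro _ ρ j<δ (from ([]ᵘ-correct u _ ρ) (subst (λ y → ⟦ u ⟧ᵘ y ρ) x≡-t+[1+j] hx))
    where
    x≡-t+[x+t] : ∀ x t → x ≡ - t + (x + t)
    x≡-t+[x+t] = solve-∀
    x≡-t+[1+j] : x ≡ - ⟦ t ⟧ˡ ρ + +[1+ j ]
    x≡-t+[1+j] = trans (x≡-t+[x+t] x (⟦ t ⟧ˡ ρ)) (cong (_+_ (- ⟦ t ⟧ˡ ρ)) x+t≡)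

  cooper-sound : ∀ (u : UQF n) ρ → ⟦ cooper u ⟧ᵠ ρ → ∃ λ x → ⟦ u ⟧ᵘ x ρ
  cooper-sound u ρ (inj₁ h) with bigOr-elim _ (δ u) ρ h
  ... | j , hj with descend (λ x → ⟦ minusInf u ⟧ᵘ x ρ) {⊥} (0<δ u)
                     (λ x → inj₂ ∘ minusInf-periodic u (∣m⇒∣-m ∣-refl))
                     (threshold u ρ) (to ([]ᵘ-correct (minusInf u) (con (+ j)) ρ) hj)
  ... | inj₂ (x , x≤θ , hx) = x , from (minusInf-agrees u x≤θ) hx
  cooper-sound u ρ (inj₂ h) with anyLower-elim u _ ρ h
  ... | t , ht with bigOr-elim _ (δ u) ρ ht
  ... | j , hj = _ , to ([]ᵘ-correct u _ ρ) hj

  cooper-complete : ∀ (u : UQF n) {x} ρ → ⟦ u ⟧ᵘ x ρ → ⟦ cooper u ⟧ᵠ ρ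
  cooper-complete u ρ hx with descend (λ x → ⟦ u ⟧ᵘ x ρ) (0<δ u) step (threshold u ρ) hx
    where
    step : ∀ x → ⟦ u ⟧ᵘ x ρ → ⟦ anyLower u (justAbove u) ⟧ᵠ ρ ⊎ ⟦ u ⟧ᵘ (x - + δ u) ρ
    step x hx = Sum.swap (step-down (justAbove u) (0<δ u) (justAbove-intro u hx) u ∣-refl hx)
  ... | inj₁ near = inj₂ near
  ... | inj₂ (x , x≤θ , hx) = inj₁ (bigOr-intro _ ρ (n%d<d x (+ δ u))
          (from ([]ᵘ-correct (minusInf u) _ ρ) (minusInf-mod u (to (minusInf-agrees u x≤θ) hx))))

  -- The scaled formula constrains x = suc L * y, so it is conjoined with suc L ∣ x.
  ∃ᵠ : QF (suc n) → QF n
  ∃ᵠ p = cooper (unitise L 0 p ∧ᵘ dvdₓ L 1ℤ (con 0ℤ))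
    where
    L = coeffProduct p

  ∃ᵠ-correct : ∀ (p : QF (suc n)) ρ → (∃ λ y → ⟦ p ⟧ᵠ (y ∷ ρ)) ⇔ ⟦ ∃ᵠ p ⟧ᵠ ρ
  ∃ᵠ-correct p ρ = mk⇔
    (λ (y , py) → cooper-complete u ρ (from (unitised y) py , divides y (1*ℓy+0≡yℓ ℓ y)))
    (λ h → let (x , ux , divides y 1*x+0≡yℓ) = cooper-sound u ρ h in
           y , to (unitised y) (subst (λ x → ⟦ unitise L 0 p ⟧ᵘ x ρ) (x≡ℓy 1*x+0≡yℓ) ux))
    where
    L = coeffProduct p
    ℓ = + suc L
    u = unitise L 0 p ∧ᵘ dvdₓ L 1ℤ (con 0ℤ)
    unitised : ∀ y → ⟦ unitise L 0 p ⟧ᵘ (ℓ * y) ρ ⇔ ⟦ p ⟧ᵠ (y ∷ ρ)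
    unitised y = unitise-correct L 0 p (ℕₚ.*-identityˡ (suc L)) y ρ
    1*ℓy+0≡yℓ : ∀ ℓ y → 1ℤ * (ℓ * y) + 0ℤ ≡ y * ℓ
    1*ℓy+0≡yℓ = solve-∀
    x≡1*x+0 : ∀ x → x ≡ 1ℤ * x + 0ℤ
    x≡1*x+0 = solve-∀
    x≡ℓy : ∀ {x y} → 1ℤ * x + 0ℤ ≡ y * ℓ → x ≡ ℓ * y
    x≡ℓy {x} {y} eq = trans (x≡1*x+0 x) (trans eq (*-comm y ℓ))

  lin : Term n → Lin n
  lin (var i) = var i
  lin zer = con 0ℤ
  lin one = con 1ℤ
  lin (s ⊕ t) = lin s ⊞ lin t
  lin (⊖ t) = ⊟ lin t

  lin-correct : ∀ (t : Term n) ρ → ⟦ lin t ⟧ˡ ρ ≡ ⟦ t ⟧t ρ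
  lin-correct (var i) ρ = refl
  lin-correct zer ρ = refl
  lin-correct one ρ = refl
  lin-correct (s ⊕ t) ρ = cong₂ _+_ (lin-correct s ρ) (lin-correct t ρ)
  lin-correct (⊖ t) ρ = cong -_ (lin-correct t ρ)

  ≤-lin : ∀ (s t : Term n) ρ → ⟦ s ⟧t ρ ≤ ⟦ t ⟧t ρ ⇔ ⟦ lin s ≤ˡ lin t ⟧ᵠ ρ
  ≤-lin s t ρ = ≤ˡ-correct (lin s) (lin t) ρ ⇔-∘ ≡⇒⇔ (sym (cong₂ _≤_ (lin-correct s ρ) (lin-correct t ρ)))

  <-lin : ∀ (s t : Term n) ρ → ⟦ s ⟧t ρ < ⟦ t ⟧t ρ ⇔ ⟦ lin s <ˡ lin t ⟧ᵠ ρ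
  <-lin s t ρ = <ˡ-correct (lin s) (lin t) ρ ⇔-∘ ≡⇒⇔ (sym (cong₂ _<_ (lin-correct s ρ) (lin-correct t ρ)))

  qe : Formula n → QF n
  qe (s ≐ t) = lin s ≤ˡ lin t ∧ᵠ lin t ≤ˡ lin s
  qe (s ≺ t) = lin s <ˡ lin t
  qe (s ≼ t) = lin s ≤ˡ lin t
  qe ⊤′ = ⊤ᵠ
  qe ⊥′ = ⊥ᵠ
  qe (¬′ φ) = negᵠ (qe φ)
  qe (φ ∧′ ψ) = qe φ ∧ᵠ qe ψ
  qe (φ ∨′ ψ) = qe φ ∨ᵠ qe ψ
  qe (φ ⇒′ ψ) = negᵠ (qe φ) ∨ᵠ qe ψ
  qe (∀′ φ) = negᵠ (∃ᵠ (negᵠ (qe φ)))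
  qe (∃′ φ) = ∃ᵠ (qe φ)

  qe-correct : ∀ (φ : Formula n) ρ → ⟦ φ ⟧ ρ ⇔ ⟦ qe φ ⟧ᵠ ρ
  qe-correct (s ≐ t) ρ = (≤-lin s t ρ ×-⇔ ≤-lin t s ρ) ⇔-∘ ≡⇔≤×≥
  qe-correct (s ≺ t) ρ = <-lin s t ρ
  qe-correct (s ≼ t) ρ = ≤-lin s t ρ
  qe-correct ⊤′ ρ = ⇔-id _
  qe-correct ⊥′ ρ = ⇔-id _
  qe-correct (¬′ φ) ρ = negᵠ-correct (qe φ) ρ ⇔-∘ ¬-cong-⇔ (qe-correct φ ρ)
  qe-correct (φ ∧′ ψ) ρ = qe-correct φ ρ ×-⇔ qe-correct ψ ρ
  qe-correct (φ ∨′ ψ) ρ = qe-correct φ ρ ⊎-⇔ qe-correct ψ ρ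
  qe-correct (φ ⇒′ ψ) ρ =
    (⟦ φ ⟧ ρ → ⟦ ψ ⟧ ρ)            ∼⟨ →-cong-⇔ (qe-correct φ ρ) (qe-correct ψ ρ) ⟩
    (⟦ qe φ ⟧ᵠ ρ → ⟦ qe ψ ⟧ᵠ ρ)    ∼⟨ →⇔¬⊎ (⟦ qe φ ⟧ᵠ? ρ) ⟩
    (¬ ⟦ qe φ ⟧ᵠ ρ ⊎ ⟦ qe ψ ⟧ᵠ ρ)  ∼⟨ negᵠ-correct (qe φ) ρ ⊎-⇔ ⇔-id _ ⟩
    ⟦ qe (φ ⇒′ ψ) ⟧ᵠ ρ             ∎
    where open EquationalReasoning
  qe-correct (∀′ φ) ρ =
    (∀ y → ⟦ φ ⟧ (y ∷ ρ))                  ∼⟨ ∀-cong-⇔ (λ y → qe-correct φ (y ∷ ρ)) ⟩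
    (∀ y → ⟦ qe φ ⟧ᵠ (y ∷ ρ))              ∼⟨ ∀⇔¬∃¬ (λ y → ⟦ qe φ ⟧ᵠ? (y ∷ ρ)) ⟩
    (¬ ∃ λ y → ¬ ⟦ qe φ ⟧ᵠ (y ∷ ρ))        ∼⟨ ¬-cong-⇔ (∃-cong-⇔ (λ y → negᵠ-correct (qe φ) (y ∷ ρ))) ⟩
    (¬ ∃ λ y → ⟦ negᵠ (qe φ) ⟧ᵠ (y ∷ ρ))   ∼⟨ ¬-cong-⇔ (∃ᵠ-correct (negᵠ (qe φ)) ρ) ⟩
    (¬ ⟦ ∃ᵠ (negᵠ (qe φ)) ⟧ᵠ ρ)            ∼⟨ negᵠ-correct (∃ᵠ (negᵠ (qe φ))) ρ ⟩
    ⟦ qe (∀′ φ) ⟧ᵠ ρ                       ∎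
    where open EquationalReasoning
  qe-correct (∃′ φ) ρ = ∃ᵠ-correct (qe φ) ρ ⇔-∘ ∃-cong-⇔ (λ y → qe-correct φ (y ∷ ρ))

  ⟦_⟧? : (φ : Formula n) (ρ : Vec ℤ n) → Dec (⟦ φ ⟧ ρ)
  ⟦ φ ⟧? ρ = Dec.map (⇔-sym (qe-correct φ ρ)) (⟦ qe φ ⟧ᵠ? ρ)

open import Data.Nat using (ℕ; suc; _≤_; _<_)
open import Data.Nat.Properties using (≮⇒≥; anyUpTo?)
open import Data.Nat.Induction using (<-wellFounded)
open import Data.Integer as ℤ using (ℤ; +_; _-_; ∣_∣)
open import Data.Integer.Properties using (+∣i∣≡i⊎+∣i∣≡-i; ∣-i∣≡∣i∣)
open import Data.Integer.Tactic.RingSolver using (solve-∀)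
open import Data.Vec using (Vec; _∷_)
open import Data.Product using (Σ; ∃; _×_; _,_)
open import Data.Sum using (_⊎_; inj₁; inj₂)
open import Induction.WellFounded using (Acc; acc)
open import Relation.Nullary using (¬_; Dec; yes; no)
open import Relation.Nullary.Decidable using (_⊎-dec_)
open import Relation.Binary.PropositionalEquality using (_≡_; sym; trans; cong; subst)
open Presburger using (⟦_⟧?)

-- Nearest solutions

module _ {P : ℕ → Set} (P? : ∀ d → Dec (P d)) where

  least : ∀ {k} → P k → ∃ λ d → P d × ∀ {e} → e < d → ¬ P e
  least = leastFrom (<-wellFounded _)
    where
    leastFrom : ∀ {k} → Acc _<_ k → P k → ∃ λ d → P d × ∀ {e} → e < d → ¬ P e
    leastFrom {k} (acc smaller) Pk with anyUpTo? P? k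
    ... | yes (e , e<k , Pe) = leastFrom (smaller e<k) Pe
    ... | no ∄e<k = k , Pk , λ e<k Pe → ∄e<k (_ , e<k , Pe)

module _ {P : ℤ → Set} (P? : ∀ y → Dec (P y)) (z : ℤ) where

  AtDistance : ℕ → Set
  AtDistance d = P (z - + d) ⊎ P (z ℤ.+ + d)

  at-distance : ∀ {w} → P w → AtDistance ∣ w - z ∣
  at-distance {w} Pw with +∣i∣≡i⊎+∣i∣≡-i (w - z)
  ... | inj₁ ∣w-z∣≡w-z = inj₂ (subst P (trans (w≡z+[w-z] z w) (cong (ℤ._+_ z) (sym ∣w-z∣≡w-z))) Pw)
    where
    w≡z+[w-z] : ∀ z w → w ≡ z ℤ.+ (w - z)
    w≡z+[w-z] = solve-∀
  ... | inj₂ ∣w-z∣≡z-w = inj₁ (subst P (trans (w≡z-[z-w] z w) (cong (z -_) (sym ∣w-z∣≡z-w))) Pw)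
    where
    w≡z-[z-w] : ∀ z w → w ≡ z - ℤ.- (w - z)
    w≡z-[z-w] = solve-∀

  distance : ∀ {d} → AtDistance d → Σ ℤ λ y → P y × ∣ y - z ∣ ≡ d
  distance {d} (inj₁ P[z-d]) = z - + d , P[z-d] , trans (cong ∣_∣ (z-d-z≡-d z (+ d))) (∣-i∣≡∣i∣ (+ d))
    where
    z-d-z≡-d : ∀ z d → z - d - z ≡ ℤ.- d
    z-d-z≡-d = solve-∀
  distance {d} (inj₂ P[z+d]) = z ℤ.+ + d , P[z+d] , cong ∣_∣ (z+d-z≡d z (+ d))
    where
    z+d-z≡d : ∀ z d → z ℤ.+ d - z ≡ d
    z+d-z≡d = solve-∀

  nearest : (∃ λ y → P y) → Σ ℤ λ y → P y × ((w : ℤ) → P w → ∣ y - z ∣ ≤ ∣ w - z ∣)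
  nearest (_ , Py₀) with least (λ d → P? (z - + d) ⊎-dec P? (z ℤ.+ + d)) (at-distance Py₀)
  ... | d , at-d , nothing-closer with distance at-d
  ... | y , Py , ∣y-z∣≡d =
    y , Py , λ w Pw → subst (_≤ ∣ w - z ∣) (sym ∣y-z∣≡d) (≮⇒≥ λ closer → nothing-closer closer (at-distance Pw))

lemma2 : (n : ℕ) (ψ : Formula (suc n)) →
         ((x : Vec ℤ n) → Σ ℤ (λ y → ⟦ ψ ⟧ (y ∷ x))) →
         (x : Vec ℤ n) (z : ℤ) →
           Σ ℤ (λ y → ⟦ ψ ⟧ (y ∷ x) ×
             ((w : ℤ) → ⟦ ψ ⟧ (w ∷ x) → ∣ y - z ∣ ≤ ∣ w - z ∣))
lemma2 n ψ solvable x z = nearest (λ y → ⟦ ψ ⟧? (y ∷ x)) z (solvable x)
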